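{- Let $g$ be a Sturmian sequence over $\{0,1\}$ with associated sequence of lower Christoffel words $w_0=01,w_1,\ldots$. Fix $\nu$, let $N=|w_\nu|$, $q=|w_\nu|_0$, and let $w_\nu=w'_\nu w''_\nu$ be its standard factorization. For $n=N-1,\ldots,|w_{\nu-1}|-1$ put $i=N-1-n$ and let $u_n$ be the word associated with the composition $(|w''_\nu|-i,\ i,\ |w'_\nu|-i)$ over the alphabet $\{a<b<c\}$. For $i\ge1$ let $h_i=(iq\bmod N)-d_i$, where $d_i$ is the number of $j\in\{1,\ldots,i\}$ with $jq\bmod N$ smaller than $iq\bmod N$. Then for each $n=N-2,\ldots,|w_{\nu-1}|-1$ (with $i=N-1-n$), writing $u_{n+1}=a_0a_1\cdots a_k$, we have $a_{h_i-1}=a$, $a_{h_i}=c$, and $$u_n=a_0\cdots a_{h_i-2}\,b\,a_{h_i+1}\cdots a_k.$$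
   Context: Positions are indexed from $0$. For a word $u$ over $\{0,1\}$, $|u|$ is its length, $|u|_0,|u|_1$ its numbers of $0$'s and $1$'s. A Sturmian sequence over $\{0,1\}$ is an infinite sequence with exactly $m+1$ distinct factors of length $m$ for each $m\ge0$; its slope is $s=\lim|u|_1/|u|_0$ over factors $u$ with $|u|\to\infty$. For coprime $p,q\ge0$, $p+q=M$, the lower Christoffel word over $\{0<1\}$ with $p$ zeros and $q$ ones is $c_0\cdots c_{M-1}$ with $c_i=1$ iff $\lfloor (i+1)q/M\rfloor>\lfloor iq/M\rfloor$; its slope is $q/p$. Each lower Christoffel word of length $\ge2$ factors uniquely as $w=w'w''$ with $w',w''$ lower Christoffel words (standard factorization). The associated sequence of $g$ is $w_0=01,w_1,\ldots$, where $w_k$ is the lower Christoffel word whose slope is the $k$-th node ($k=0$ the root $1/1$) on the infinite Stern–Brocot path towards $s$. Word associated with a composition: for nonnegative $c_1,c_2,c_3$ with sum $m$, let $I_1=\{0,\ldots,c_1-1\}$, $I_2=\{c_1,\ldots,c_1+c_2-1\}$, $I_3=\{c_1+c_2,\ldots,m-1\}$ and $\sigma(i)=i+c_2+c_3$ on $I_1$, $i+c_3-c_1$ on $I_2$, $i-c_1-c_2$ on $I_3$; when $\sigma$ is a single $m$-cycle, the associated word over $\{a<b<c\}$ is $\ell(0)\ell(\sigma(0))\cdots\ell(\sigma^{m-1}(0))$ with $\ell(i)=a,b,c$ according as $i\in I_1,I_2,I_3$. -}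

module Defs where

open import Data.Nat using (ℕ; zero; suc; _+_; _*_; _∸_; _<_; _≤_; _<?_)
open import Data.Nat.DivMod using (_/_; _%_)
open import Data.Nat.Coprimality using (Coprime)
open import Data.Bool using (Bool; true; false; if_then_else_)
open import Data.List using (List; []; _∷_; length; map; upTo; filter; _++_)
open import Data.List.Relation.Unary.Unique.Propositional using (Unique)
open import Data.List.Membership.Propositional using (_∈_)
open import Data.Maybe using (Maybe; just; nothing)
open import Data.Product using (Σ; ∃; _×_; _,_; proj₁; proj₂)
open import Data.Sum using (_⊎_)
open import Relation.Nullary using (does)
open import Relation.Binary.PropositionalEquality using (_≡_)

-- Arithmetic helpers (total versions of ⌊x/M⌋ and x mod M; only ever
-- used with M ≥ 1, where they agree with the usual operations).

divN : ℕ → ℕ → ℕ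
divN x zero    = 0
divN x (suc m) = x / suc m

modN : ℕ → ℕ → ℕ
modN x zero    = x
modN x (suc m) = x % suc m

-- Binary words: false = 0, true = 1.

BWord : Set
BWord = List Bool

count0 : BWord → ℕ
count0 []           = 0
count0 (false ∷ w)  = suc (count0 w)
count0 (true ∷ w)   = count0 w

count1 : BWord → ℕ
count1 []           = 0
count1 (false ∷ w)  = count1 w
count1 (true ∷ w)   = suc (count1 w)

-- Lower Christoffel word with p zeros and q ones (M = p + q):
-- c_i = 1 iff ⌊(i+1)q/M⌋ > ⌊iq/M⌋.
christoffel : ℕ → ℕ → BWord
christoffel p q = map letter (upTo (p + q))
  where
  letter : ℕ → Bool
  letter i = does (divN (i * q) (p + q) <? divN (suc i * q) (p + q))

IsChristoffel : BWord → Set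
IsChristoffel u = Σ ℕ λ p → Σ ℕ λ q → Coprime p q × (u ≡ christoffel p q)

Seq : Set
Seq = ℕ → Bool

factor : Seq → ℕ → ℕ → BWord
factor g i m = map (λ j → g (i + j)) (upTo m)

IsFactor : Seq → BWord → Set
IsFactor g u = ∃ λ i → factor g i (length u) ≡ u

Sturmian : Seq → Set
Sturmian g = ∀ m → Σ (List BWord) λ fs →
    (length fs ≡ suc m) × Unique fs
  × (∀ u → u ∈ fs → length u ≡ m × IsFactor g u)
  × (∀ i → factor g i m ∈ fs)

-- Comparison of the slope s = lim |u|_1/|u|_0 of g with the rational x/y
-- (x ones over y zeros), expressed through the defining limit:
-- "s < x/y" : all sufficiently long factors u satisfy |u|_1/|u|_0 < x/y.
SlopeBelow : Seq → ℕ → ℕ → Set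
SlopeBelow g x y = ∃ λ L → ∀ i m → L ≤ m →
  y * count1 (factor g i m) < x * count0 (factor g i m)

SlopeAbove : Seq → ℕ → ℕ → Set
SlopeAbove g x y = ∃ λ L → ∀ i m → L ≤ m →
  x * count0 (factor g i m) < y * count1 (factor g i m)

-- Stern–Brocot path. A state is the pair of bounds
-- (left = lo1/lo0, right = hi1/hi0), fractions written ones/zeros;
-- the current node is their mediant.

record Bounds : Set where
  constructor bounds
  field
    lo1 lo0 hi1 hi0 : ℕ

open Bounds public

nodeOnes : Bounds → ℕ
nodeOnes b = lo1 b + hi1 b

nodeZeros : Bounds → ℕ
nodeZeros b = lo0 b + hi0 b

rootBounds : Bounds
rootBounds = bounds 0 1 1 0

goLeft : Bounds → Bounds
goLeft b = bounds (lo1 b) (lo0 b) (nodeOnes b) (nodeZeros b)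

goRight : Bounds → Bounds
goRight b = bounds (nodeOnes b) (nodeZeros b) (hi1 b) (hi0 b)

-- bs k are the bounds whose mediant is the k-th node of the infinite
-- Stern–Brocot path towards the slope of g.
IsSBPath : Seq → (ℕ → Bounds) → Set
IsSBPath g bs = (bs 0 ≡ rootBounds) × (∀ k →
    (SlopeBelow g (nodeOnes (bs k)) (nodeZeros (bs k)) × (bs (suc k) ≡ goLeft (bs k)))
  ⊎ (SlopeAbove g (nodeOnes (bs k)) (nodeZeros (bs k)) × (bs (suc k) ≡ goRight (bs k))))

nodeWord : Bounds → BWord
nodeWord b = christoffel (nodeZeros b) (nodeOnes b)

data Letter : Set where
  a b c : Letter

sigma : ℕ → ℕ → ℕ → ℕ → ℕ
sigma c1 c2 c3 i =
  if does (i <? c1) then i + c2 + c3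
  else if does (i <? c1 + c2) then i + c3 ∸ c1
  else i ∸ c1 ∸ c2

ell : ℕ → ℕ → ℕ → Letter
ell c1 c2 i =
  if does (i <? c1) then a
  else if does (i <? c1 + c2) then b
  else c

iter : (ℕ → ℕ) → ℕ → ℕ → ℕ
iter f zero    x = x
iter f (suc k) x = f (iter f k x)

-- ℓ(0) ℓ(σ(0)) ⋯ ℓ(σ^{m-1}(0)), m = c1 + c2 + c3
-- (this is the associated word whenever σ is a single m-cycle)
assocWord : ℕ → ℕ → ℕ → List Letter
assocWord c1 c2 c3 =
  map (λ j → ell c1 c2 (iter (sigma c1 c2 c3) j 0)) (upTo (c1 + c2 + c3))

at : {A : Set} → List A → ℕ → Maybe A
at []       _       = nothing
at (x ∷ xs) zero    = just x
at (x ∷ xs) (suc k) = at xs k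

countUpTo : (ℕ → Bool) → ℕ → ℕ
countUpTo P zero    = 0
countUpTo P (suc k) = (if P (suc k) then suc else (λ z → z)) (countUpTo P k)

dNum : ℕ → ℕ → ℕ → ℕ
dNum N q i = countUpTo (λ j → does (modN (j * q) N <? modN (i * q) N)) i

hNum : ℕ → ℕ → ℕ → ℕ
hNum N q i = modN (i * q) N ∸ dNum N q i

uWord : BWord → BWord → ℕ → ℕ → List Letter
uWord w' w'' N n = assocWord (length w'' ∸ i) i (length w' ∸ i)
  where
  i : ℕ
  i = N ∸ 1 ∸ n

-- Write N = |w_ν|, C = |w′_ν|, A = |w″_ν| and q = |w_ν|₀. Unimodularity of the Stern–Brocot bounds
-- forces a factorization of w_ν into two Christoffel words to be the standard one, and gives
-- C·q ≡ −1 (mod N). For 1 ≤ i ≤ min(A, C) the map σ of the composition (A − i, i, C − i) is the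
-- first-return map of the rotation z ↦ z + C (mod N) to [0, N − i), so u_n spells ℓ along the rotation
-- orbit of 0 with the points N − 1, …, N − i skipped; as C·q ≡ −1, the point N − j is reached at time
-- jq mod N. Passing from u_{n+1} to u_n skips one more point, N − i, reached at time K = iq mod N
-- directly from A − i. In u_{n+1} these two points contribute the letters a and c; in u_n the point
-- A − i contributes b and N − i nothing, while all other letters stay the same because only the
-- boundary between the a- and b-intervals moves. The merged letter sits at the number of visits to
-- [0, N − i) before time K, which is K − d_i = h_i.

module Submission where

open import Defs
open import Data.Nat using (ℕ; suc; _+_; _*_; _∸_; _≤_; _<_)
open import Data.List using (List; _∷_; _++_; length; take; drop)
open import Data.Maybe using (just)
open import Data.Product using (_×_)
open import Relation.Binary.PropositionalEquality using (_≡_)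

open import Data.Bool using (Bool; true; false)
open import Data.List using ([]; [_]; map; upTo; applyUpTo)
open import Data.List.Properties using (map-upTo; length-map; length-upTo; applyUpTo-∷ʳ; take-all; length-++)
open import Data.Maybe using (nothing)
open import Data.Nat using (zero; pred; z≤n; s≤s; z<s; _<?_; _≟_; NonZero; ≢-nonZero; >-nonZero⁻¹; _/_; _%_)
open import Data.Nat.DivMod
open import Data.Nat.Divisibility using (divides; ∣-refl; ∣⇒≤)
open import Data.Nat.Coprimality using (Coprime; coprime-divisor; coprime-+; 0-coprimeTo-m⇒m≡1)
open import Data.Nat.Properties
open import Algebra.Properties.CommutativeSemigroup +-commutativeSemigroup using (interchange; xy∙z≈xz∙y)
open import Data.Product using (∃-syntax; _,_; proj₁; proj₂)
open import Data.Sum using (_⊎_; inj₁; inj₂)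
open import Function using (_∘_; case_of_)
open import Relation.Binary.Definitions using (tri<; tri≈; tri>)
open import Relation.Binary.PropositionalEquality using (refl; sym; trans; cong; cong₂; subst; subst₂; _≢_; module ≡-Reasoning)
open import Relation.Nullary using (¬_; Dec; yes; no; does; contradiction)
open import Relation.Nullary.Decidable using (dec-true; dec-false)
open import Relation.Unary using (Decidable)
open import Data.Nat.Tactic.RingSolver using (solve)

module _ {A : Set} where

  at-applyUpTo : (f : ℕ → A) {m j : ℕ} → j < m → at (applyUpTo f m) j ≡ just (f j)
  at-applyUpTo f {suc m} {zero}  _         = refl
  at-applyUpTo f {suc m} {suc j} (s≤s j<m) = at-applyUpTo (f ∘ suc) j<m

  at-applyUpTo-≥ : (f : ℕ → A) {m j : ℕ} → m ≤ j → at (applyUpTo f m) j ≡ nothing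
  at-applyUpTo-≥ f {zero}          _         = refl
  at-applyUpTo-≥ f {suc m} {suc j} (s≤s m≤j) = at-applyUpTo-≥ (f ∘ suc) m≤j

  at-extensional : {xs ys : List A} → (∀ j → at xs j ≡ at ys j) → xs ≡ ys
  at-extensional {[]}     {[]}     _  = refl
  at-extensional {[]}     {y ∷ ys} eq with () ← eq 0
  at-extensional {x ∷ xs} {[]}     eq with () ← eq 0
  at-extensional {x ∷ xs} {y ∷ ys} eq with refl ← eq 0 = cong (x ∷_) (at-extensional (eq ∘ suc))

  at-drop : (xs : List A) (k j : ℕ) → at (drop k xs) j ≡ at xs (k + j)
  at-drop xs       zero    j = refl
  at-drop []       (suc k) j = refl
  at-drop (x ∷ xs) (suc k) j = at-drop xs k j

  take-applyUpTo : (f : ℕ → A) {k n : ℕ} → k ≤ n → take k (applyUpTo f n) ≡ applyUpTo f k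
  take-applyUpTo f {zero}          _         = refl
  take-applyUpTo f {suc k} {suc n} (s≤s k≤n) = cong (f 0 ∷_) (take-applyUpTo (f ∘ suc) k≤n)

  take-++ˡ : ∀ {m} (xs ys : List A) → m ≤ length xs → take m (xs ++ ys) ≡ take m xs
  take-++ˡ {zero}  xs       ys _         = refl
  take-++ˡ {suc m} (x ∷ xs) ys (s≤s m≤n) = cong (x ∷_) (take-++ˡ xs ys m≤n)

  take-++ʳ : ∀ m (xs ys : List A) → take (length xs + m) (xs ++ ys) ≡ xs ++ take m ys
  take-++ʳ m []       ys = refl
  take-++ʳ m (x ∷ xs) ys = cong (x ∷_) (take-++ʳ m xs ys)

  replacePair : ℕ → A → List A → List A
  replacePair h y xs = take h xs ++ y ∷ drop (2 + h) xs

  at-replacePair-< : ∀ {h j} (y : A) (xs : List A) → j < h → h ≤ length xs →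
                     at (replacePair h y xs) j ≡ at xs j
  at-replacePair-< {suc h} {zero}  y (x ∷ xs) _         _         = refl
  at-replacePair-< {suc h} {suc j} y (x ∷ xs) (s≤s j<h) (s≤s h≤n) = at-replacePair-< y xs j<h h≤n

  at-replacePair-≡ : ∀ {h} (y : A) (xs : List A) → h ≤ length xs → at (replacePair h y xs) h ≡ just y
  at-replacePair-≡ {zero}  y xs       _         = refl
  at-replacePair-≡ {suc h} y (x ∷ xs) (s≤s h≤n) = at-replacePair-≡ y xs h≤n

  at-replacePair-> : ∀ {h j} (y : A) (xs : List A) → h < j → h ≤ length xs →
                     at (replacePair h y xs) j ≡ at xs (suc j)
  at-replacePair-> {zero}  {suc j} y xs       _         _         = at-drop xs 2 j
  at-replacePair-> {suc h} {suc j} y (x ∷ xs) (s≤s h<j) (s≤s h≤n) = at-replacePair-> y xs h<j h≤n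

-- The three-interval exchange and its coding

length-assocWord : ∀ c₁ c₂ c₃ → length (assocWord c₁ c₂ c₃) ≡ c₁ + c₂ + c₃
length-assocWord c₁ c₂ c₃ = trans (length-map _ (upTo (c₁ + c₂ + c₃))) (length-upTo (c₁ + c₂ + c₃))

at-assocWord : ∀ {c₁ c₂ c₃ j} → j < c₁ + c₂ + c₃ →
               at (assocWord c₁ c₂ c₃) j ≡ just (ell c₁ c₂ (iter (sigma c₁ c₂ c₃) j 0))
at-assocWord {c₁} {c₂} {c₃} j<m rewrite map-upTo (λ j → ell c₁ c₂ (iter (sigma c₁ c₂ c₃) j 0)) (c₁ + c₂ + c₃) =
  at-applyUpTo _ j<m

at-assocWord-≥ : ∀ {c₁ c₂ c₃ j} → c₁ + c₂ + c₃ ≤ j → at (assocWord c₁ c₂ c₃) j ≡ nothing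
at-assocWord-≥ {c₁} {c₂} {c₃} m≤j rewrite map-upTo (λ j → ell c₁ c₂ (iter (sigma c₁ c₂ c₃) j 0)) (c₁ + c₂ + c₃) =
  at-applyUpTo-≥ _ m≤j

data Region (c₁ c₂ : ℕ) : ℕ → Set where
  left   : ∀ {z} → z < c₁ → Region c₁ c₂ z
  middle : ∀ {u} → u < c₂ → Region c₁ c₂ (c₁ + u)
  right  : ∀ y → Region c₁ c₂ (c₁ + c₂ + y)

region : ∀ c₁ c₂ z → Region c₁ c₂ z
region c₁ c₂ z with z <? c₁
... | yes z<c₁ = left z<c₁
... | no z≮c₁ with m≤n⇒∃[o]m+o≡n (≮⇒≥ z≮c₁)
...   | u , refl with u <? c₂
...     | yes u<c₂ = middle u<c₂
...     | no u≮c₂ with m≤n⇒∃[o]m+o≡n (≮⇒≥ u≮c₂)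
...       | y , refl = subst (Region c₁ c₂) (+-assoc c₁ c₂ y) (right y)

module _ {c₁ c₂ c₃ : ℕ} where

  sigma-left : ∀ {z} → z < c₁ → sigma c₁ c₂ c₃ z ≡ z + c₂ + c₃
  sigma-left {z} z<c₁ rewrite dec-true (z <? c₁) z<c₁ = refl

  sigma-middle : ∀ {u} → u < c₂ → sigma c₁ c₂ c₃ (c₁ + u) ≡ u + c₃
  sigma-middle {u} u<c₂
    rewrite dec-false (c₁ + u <? c₁) (m+n≮m c₁ u) | dec-true (c₁ + u <? c₁ + c₂) (+-monoʳ-< c₁ u<c₂)
    = trans (cong (_∸ c₁) (+-assoc c₁ u c₃)) (m+n∸m≡n c₁ (u + c₃))

  sigma-right : ∀ y → sigma c₁ c₂ c₃ (c₁ + c₂ + y) ≡ y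
  sigma-right y
    rewrite dec-false (c₁ + c₂ + y <? c₁) (m+n≮m c₁ c₂ ∘ ≤-<-trans (m≤m+n (c₁ + c₂) y))
          | dec-false (c₁ + c₂ + y <? c₁ + c₂) (m+n≮m (c₁ + c₂) y)
    = trans (cong (_∸ c₂) (trans (cong (_∸ c₁) (+-assoc c₁ c₂ y)) (m+n∸m≡n c₁ (c₂ + y)))) (m+n∸m≡n c₂ y)

module _ {c₁ c₂ : ℕ} where

  ell-left : ∀ {z} → z < c₁ → ell c₁ c₂ z ≡ a
  ell-left {z} z<c₁ rewrite dec-true (z <? c₁) z<c₁ = refl

  ell-middle : ∀ {z} → c₁ ≤ z → z < c₁ + c₂ → ell c₁ c₂ z ≡ b
  ell-middle {z} c₁≤z z<c
    rewrite dec-false (z <? c₁) (≤⇒≯ c₁≤z) | dec-true (z <? c₁ + c₂) z<c = refl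

  ell-right : ∀ {z} → c₁ + c₂ ≤ z → ell c₁ c₂ z ≡ c
  ell-right {z} c≤z
    rewrite dec-false (z <? c₁) (≤⇒≯ (≤-trans (m≤m+n c₁ c₂) c≤z)) | dec-false (z <? c₁ + c₂) (≤⇒≯ c≤z) = refl

ell-moveBoundary : ∀ {c₁ c₂ z} → z ≢ c₁ → ell c₁ (suc c₂) z ≡ ell (suc c₁) c₂ z
ell-moveBoundary {c₁} {c₂} {z} z≢c₁ with <-cmp z c₁
... | tri< z<c₁ _ _ = trans (ell-left z<c₁) (sym (ell-left (m<n⇒m<1+n z<c₁)))
... | tri≈ _ z≡c₁ _ = contradiction z≡c₁ z≢c₁
... | tri> _ _ c₁<z with z <? c₁ + suc c₂
...   | yes z<c = trans (ell-middle {c₁} (<⇒≤ c₁<z) z<c)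
                      (sym (ell-middle {suc c₁} c₁<z (subst (z <_) (+-suc c₁ c₂) z<c)))
...   | no z≮c = trans (ell-right {c₁} (≮⇒≥ z≮c))
                     (sym (ell-right {suc c₁} (subst (_≤ z) (+-suc c₁ c₂) (≮⇒≥ z≮c))))

-- Counting and first returns

indicator : Bool → ℕ
indicator true  = 1
indicator false = 0

countBelow : (ℕ → Bool) → ℕ → ℕ
countBelow P zero    = 0
countBelow P (suc k) = indicator (P k) + countBelow P k

module _ {P : ℕ → Bool} where

  countBelow-true : ∀ {k} → P k ≡ true → countBelow P (suc k) ≡ suc (countBelow P k)
  countBelow-true Pk rewrite Pk = refl

  countBelow-false : ∀ {k} → P k ≡ false → countBelow P (suc k) ≡ countBelow P k
  countBelow-false Pk rewrite Pk = refl

  countBelow-all : (∀ k → P k ≡ true) → ∀ k → countBelow P k ≡ k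
  countBelow-all all zero    = refl
  countBelow-all all (suc k) = trans (countBelow-true (all k)) (cong suc (countBelow-all all k))

  countBelow-mono : ∀ {k k′} → k ≤ k′ → countBelow P k ≤ countBelow P k′
  countBelow-mono {k′ = zero}   z≤n    = ≤-refl
  countBelow-mono {k′ = suc k′} k≤1+k′ with m≤n⇒m<n∨m≡n k≤1+k′
  ... | inj₁ k<1+k′ = ≤-trans (countBelow-mono (m<1+n⇒m≤n k<1+k′)) (m≤n+m _ (indicator (P k′)))
  ... | inj₂ refl   = ≤-refl

countBelow-preimage : ∀ {Q : ℕ → Set} (Q? : Decidable Q) {j} k → j < countBelow (does ∘ Q?) k →
                      ∃[ k′ ] k′ < k × Q k′ × countBelow (does ∘ Q?) k′ ≡ j
countBelow-preimage Q? (suc k) j<n with Q? k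
... | no _ = let k′ , k′<k , rest = countBelow-preimage Q? k j<n in k′ , m<n⇒m<1+n k′<k , rest
... | yes Qk with m≤n⇒m<n∨m≡n (m<1+n⇒m≤n j<n)
...   | inj₁ j<n′ = let k′ , k′<k , rest = countBelow-preimage Q? k j<n′ in k′ , m<n⇒m<1+n k′<k , rest
...   | inj₂ refl = k , ≤-refl , Qk , refl

countBelow-single : ∀ {Q : ℕ → Set} (Q? : Decidable Q) {K N} → Q K → (∀ {k} → k < N → Q k → k ≡ K) →
                    ∀ {k} → k ≤ N → countBelow (does ∘ Q?) k ≡ indicator (does (K <? k))
countBelow-single Q? {K} QK unique {zero}  _   = refl
countBelow-single Q? {K} QK unique {suc k} k<N with <-cmp K k | Q? k
... | tri≈ _ refl _ | no ¬QK = contradiction QK ¬QK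
... | tri< K<k _ _  | yes Qk = contradiction (unique k<N Qk) (>⇒≢ K<k)
... | tri> _ _ k<K  | yes Qk = contradiction (unique k<N Qk) (<⇒≢ k<K)
... | tri≈ _ refl _ | yes _
  rewrite countBelow-single Q? QK unique (<⇒≤ k<N) | dec-false (K <? K) (n≮n K) | dec-true (K <? suc K) (n<1+n K)
  = refl
... | tri< K<k _ _  | no _
  rewrite countBelow-single Q? QK unique (<⇒≤ k<N) | dec-true (K <? k) K<k | dec-true (K <? suc k) (m<n⇒m<1+n K<k)
  = refl
... | tri> _ _ k<K  | no _
  rewrite countBelow-single Q? QK unique (<⇒≤ k<N) | dec-false (K <? k) (<⇒≯ k<K)
        | dec-false (K <? suc k) (<⇒≱ k<K ∘ m<1+n⇒m≤n)
  = refl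

countBelow-+ : ∀ {P Q R : ℕ → Bool} → (∀ k → indicator (R k) ≡ indicator (P k) + indicator (Q k)) →
               ∀ k → countBelow R k ≡ countBelow P k + countBelow Q k
countBelow-+ split zero = refl
countBelow-+ {P} {Q} {R} split (suc k) = begin
  indicator (R k) + countBelow R k            ≡⟨ cong₂ _+_ (split k) (countBelow-+ split k) ⟩
  (p + q) + (countBelow P k + countBelow Q k) ≡⟨ interchange p q (countBelow P k) (countBelow Q k) ⟩
  (p + countBelow P k) + (q + countBelow Q k) ∎
  where open ≡-Reasoning
        p q : ℕ
        p = indicator (P k)
        q = indicator (Q k)

indicator-<-suc : ∀ z m → indicator (does (z <? suc m)) ≡ indicator (does (z <? m)) + indicator (does (z ≟ m))
indicator-<-suc z m with <-cmp z m
... | tri< z<m z≢m _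
  rewrite dec-true (z <? suc m) (m<n⇒m<1+n z<m) | dec-true (z <? m) z<m | dec-false (z ≟ m) z≢m = refl
... | tri≈ _ refl _
  rewrite dec-true (z <? suc z) (n<1+n z) | dec-false (z <? z) (n≮n z) | dec-true (z ≟ z) refl = refl
... | tri> _ z≢m m<z
  rewrite dec-false (z <? suc m) (<⇒≱ m<z ∘ m<1+n⇒m≤n) | dec-false (z <? m) (<⇒≯ m<z) | dec-false (z ≟ m) z≢m = refl

countUpTo-suc : ∀ (P : ℕ → Bool) i → countUpTo P (suc i) ≡ indicator (P (suc i)) + countUpTo P i
countUpTo-suc P i with P (suc i)
... | true  = refl
... | false = refl

countUpTo-all : ∀ {P : ℕ → Bool} → (∀ j → P j ≡ true) → ∀ i → countUpTo P i ≡ i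
countUpTo-all {P} all zero    = refl
countUpTo-all {P} all (suc i) rewrite all (suc i) = cong suc (countUpTo-all all i)

module FirstReturn (x σ : ℕ → ℕ) {S : ℕ → Set} (S? : Decidable S)
  (start       : S (x 0))
  (return₁     : ∀ k → S (x k) → S (x (suc k)) → σ (x k) ≡ x (suc k))
  (return₂     : ∀ k → S (x k) → ¬ S (x (suc k)) → σ (x k) ≡ x (2 + k))
  (exit-from-S : ∀ k → ¬ S (x (suc k)) → S (x k))
  where

  visited : ℕ → Bool
  visited k = does (S? (x k))

  visits : ℕ → ℕ
  visits = countBelow visited

  private
    Claim : ℕ → Set
    Claim k = S (x k) → iter σ (visits k) (x 0) ≡ x k

    iterσ : ℕ → ℕ
    iterσ n = iter σ n (x 0)

    claim-suc : ∀ k → Claim k → S (x k) → Claim (suc k)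
    claim-suc k ih s s′ = begin
      iterσ (visits (suc k)) ≡⟨ cong iterσ (countBelow-true {visited} (dec-true (S? (x k)) s)) ⟩
      σ (iterσ (visits k))   ≡⟨ cong σ (ih s) ⟩
      σ (x k)                ≡⟨ return₁ k s s′ ⟩
      x (suc k)              ∎
      where open ≡-Reasoning

    claim-skip : ∀ k → Claim k → ¬ S (x (suc k)) → Claim (2 + k)
    claim-skip k ih ¬s′ _ = begin
      iterσ (visits (2 + k)) ≡⟨ cong iterσ (countBelow-false {visited} (dec-false (S? (x (suc k))) ¬s′)) ⟩
      iterσ (visits (suc k)) ≡⟨ cong iterσ (countBelow-true {visited} (dec-true (S? (x k)) s)) ⟩
      σ (iterσ (visits k))   ≡⟨ cong σ (ih s) ⟩
      σ (x k)                ≡⟨ return₂ k s ¬s′ ⟩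
      x (2 + k)              ∎
      where open ≡-Reasoning
            s : S (x k)
            s = exit-from-S k ¬s′

    claim-2+ : ∀ k → Claim k → Claim (suc k) → Claim (2 + k)
    claim-2+ k ih ih′ = case S? (x (suc k)) of λ where
      (yes s′) → claim-suc (suc k) ih′ s′
      (no ¬s′) → claim-skip k ih ¬s′

    claims : ∀ k → Claim k × Claim (suc k)
    claims zero    = (λ _ → refl) , claim-suc 0 (λ _ → refl) start
    claims (suc k) = let ih , ih′ = claims k in ih′ , claim-2+ k ih ih′

  iter-visits : ∀ k → S (x k) → iter σ (visits k) (x 0) ≡ x k
  iter-visits k = proj₁ (claims k)

-- Division with remainder and prefixes of Christoffel words

divN-unique : ∀ {M x r t} → r < M → x ≡ r + t * M → divN x M ≡ t
divN-unique {suc M} {r = r} {t} r<M refl = begin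
  (r + t * suc M) / suc M           ≡⟨ +-distrib-/-∣ʳ r (divides t refl) ⟩
  r / suc M + t * suc M / suc M     ≡⟨ cong₂ _+_ (m<n⇒m/n≡0 r<M) (m*n/n≡m t (suc M)) ⟩
  t                                 ∎
  where open ≡-Reasoning

modN+divN : ∀ {M} x → 0 < M → x ≡ modN x M + divN x M * M
modN+divN {suc M} x _ = m≡m%n+[m/n]*n x (suc M)

modN<M : ∀ {M} x → 0 < M → modN x M < M
modN<M {suc M} x _ = m%n<n x (suc M)

modN≡% : ∀ x M .{{_ : NonZero M}} → modN x M ≡ x % M
modN≡% x (suc M) = refl

%-absorbˡ : ∀ m n {N} .{{_ : NonZero N}} → (m % N + n) % N ≡ (m + n) % N
%-absorbˡ m n {N} = begin
  (m % N + n) % N                ≡⟨ [m+kn]%n≡m%n (m % N + n) (m / N) N ⟨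
  (m % N + n + m / N * N) % N    ≡⟨ cong (_% N) (xy∙z≈xz∙y (m % N) n (m / N * N)) ⟩
  (m % N + m / N * N + n) % N    ≡⟨ cong (λ t → (t + n) % N) (m≡m%n+[m/n]*n m N) ⟨
  (m + n) % N                    ∎
  where open ≡-Reasoning

%-cong-mod : ∀ m n u v N .{{_ : NonZero N}} → m + u * N ≡ n + v * N → m % N ≡ n % N
%-cong-mod m n u v N eq =
  trans (sym ([m+kn]%n≡m%n m u N)) (trans (cong (_% N) eq) ([m+kn]%n≡m%n n v N))

count1-++ : ∀ (xs ys : BWord) → count1 (xs ++ ys) ≡ count1 xs + count1 ys
count1-++ []           ys = refl
count1-++ (false ∷ xs) ys = count1-++ xs ys
count1-++ (true ∷ xs)  ys = cong suc (count1-++ xs ys)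

count0+count1≡length : ∀ (w : BWord) → count0 w + count1 w ≡ length w
count0+count1≡length []          = refl
count0+count1≡length (false ∷ w) = cong suc (count0+count1≡length w)
count0+count1≡length (true ∷ w)  = trans (+-suc (count0 w) (count1 w)) (cong suc (count0+count1≡length w))

length-christoffel : ∀ p q → length (christoffel p q) ≡ p + q
length-christoffel p q = trans (length-map _ (upTo (p + q))) (length-upTo (p + q))

floorStep : ℕ → ℕ → ℕ → Bool
floorStep M q i = does (divN (i * q) M <? divN (suc i * q) M)

divN-suc : ∀ M {q} i → q ≤ M → divN (suc i * q) M ≡ count1 [ floorStep M q i ] + divN (i * q) M
divN-suc zero          i _   = refl
divN-suc M@(suc M-1) {q} i q≤M = step (f i <? f (suc i))
  where
  f : ℕ → ℕ
  f j = (j * q) / M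

  f-suc≤ : f (suc i) ≤ suc (f i)
  f-suc≤ = begin
    (q + i * q) / M     ≤⟨ /-monoˡ-≤ M (+-monoˡ-≤ (i * q) q≤M) ⟩
    (M + i * q) / M     ≡⟨ +-distrib-/-∣ˡ (i * q) ∣-refl ⟩
    M / M + f i         ≡⟨ cong (_+ f i) (n/n≡1 M) ⟩
    suc (f i)           ∎
    where open ≤-Reasoning

  step : (d : Dec (f i < f (suc i))) → f (suc i) ≡ count1 [ does d ] + f i
  step (yes fi<fi+1) = ≤-antisym f-suc≤ fi<fi+1
  step (no fi≮fi+1)  = ≤-antisym (≮⇒≥ fi≮fi+1) (/-monoˡ-≤ M (m≤n+m (i * q) q))

count1-applyUpTo-floorStep : ∀ {M q} → q ≤ M → ∀ k → count1 (applyUpTo (floorStep M q) k) ≡ divN (k * q) M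
count1-applyUpTo-floorStep {zero}  q≤M zero = refl
count1-applyUpTo-floorStep {suc M} q≤M zero = sym (0/n≡0 (suc M))
count1-applyUpTo-floorStep {M} {q} q≤M (suc k) = begin
  count1 (applyUpTo L (suc k))              ≡⟨ cong count1 (applyUpTo-∷ʳ L k) ⟨
  count1 (applyUpTo L k ++ [ L k ])         ≡⟨ count1-++ (applyUpTo L k) [ L k ] ⟩
  count1 (applyUpTo L k) + count1 [ L k ]   ≡⟨ cong (_+ count1 [ L k ]) (count1-applyUpTo-floorStep q≤M k) ⟩
  divN (k * q) M + count1 [ L k ]           ≡⟨ +-comm (divN (k * q) M) _ ⟩
  count1 [ L k ] + divN (k * q) M           ≡⟨ divN-suc M k q≤M ⟨
  divN (suc k * q) M                        ∎
  where open ≡-Reasoning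
        L : ℕ → Bool
        L = floorStep M q

count1-take-christoffel : ∀ p q {k} → k ≤ p + q → count1 (take k (christoffel p q)) ≡ divN (k * q) (p + q)
count1-take-christoffel p q {k} k≤M = begin
  count1 (take k (christoffel p q))               ≡⟨ cong (count1 ∘ take k) (map-upTo L (p + q)) ⟩
  count1 (take k (applyUpTo L (p + q)))           ≡⟨ cong count1 (take-applyUpTo L k≤M) ⟩
  count1 (applyUpTo L k)                          ≡⟨ count1-applyUpTo-floorStep (m≤n+m q p) k ⟩
  divN (k * q) (p + q)                            ∎
  where open ≡-Reasoning
        L : ℕ → Bool
        L = floorStep (p + q) q

count1-christoffel⁺ : ∀ p q .{{_ : NonZero (p + q)}} → count1 (christoffel p q) ≡ q
count1-christoffel⁺ p q = begin
  count1 (christoffel p q)                 ≡⟨ cong count1 (take-all (p + q) _ (≤-reflexive (length-christoffel p q))) ⟨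
  count1 (take (p + q) (christoffel p q))  ≡⟨ count1-take-christoffel p q ≤-refl ⟩
  divN ((p + q) * q) (p + q)               ≡⟨ divN-unique (>-nonZero⁻¹ (p + q)) (*-comm (p + q) q) ⟩
  q                                        ∎
  where open ≡-Reasoning

count1-christoffel : ∀ p q → count1 (christoffel p q) ≡ q
count1-christoffel zero      zero      = refl
count1-christoffel zero      q@(suc _) = count1-christoffel⁺ zero q
count1-christoffel p@(suc _) q         = count1-christoffel⁺ p q

count0-christoffel : ∀ p q → count0 (christoffel p q) ≡ p
count0-christoffel p q = +-cancelʳ-≡ q _ p (begin
  count0 (christoffel p q) + q                      ≡⟨ cong (count0 (christoffel p q) +_) (count1-christoffel p q) ⟨
  count0 (christoffel p q) + count1 (christoffel p q) ≡⟨ count0+count1≡length (christoffel p q) ⟩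
  length (christoffel p q)                          ≡⟨ length-christoffel p q ⟩
  p + q                                             ∎)
  where open ≡-Reasoning

-- The standard factorization

coprime⇒0<+ : ∀ {p q} → Coprime p q → 0 < p + q
coprime⇒0<+ {zero}  {zero}  cop with () ← 0-coprimeTo-m⇒m≡1 cop
coprime⇒0<+ {zero}  {suc q} _   = z<s
coprime⇒0<+ {suc p} {q}     _   = z<s

coprime-+ʳ : ∀ {p q} → Coprime p q → Coprime (p + q) q
coprime-+ʳ {p} {q} cop = subst (λ n → Coprime n q) (+-comm q p) (coprime-+ cop)

coprime-multiple⇒≤ : ∀ {L q m t} → Coprime L q → 0 < m → m * q ≡ t * L → L ≤ m
coprime-multiple⇒≤ {L} {q} {suc m} {t} cop _ eq =
  ∣⇒≤ (coprime-divisor cop (divides t (trans (*-comm q (suc m)) eq)))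

*-+≡<⇒≡0 : ∀ {N e s L} → N * e + s ≡ L → L < N → e ≡ 0
*-+≡<⇒≡0 {e = zero}              _  _   = refl
*-+≡<⇒≡0 {N} {e = suc e} {s} eq L<N =
  contradiction (≤-trans (m≤m*n N (suc e)) (≤-trans (m≤m+n _ s) (≤-reflexive eq))) (<⇒≱ L<N)

Ne+kr≡C : ∀ {N C k r e l q Q} → C * Q ≡ r + q * N → k * q ≡ e + l * C → k * Q ≡ l * N + 1 →
          N * e + k * r ≡ C
Ne+kr≡C {N} {C} {k} {r} {e} {l} {q} {Q} CQ≡ kq≡ kQ≡ = +-cancelʳ-≡ (l * C * N) _ _ (begin
  N * e + k * r + l * C * N  ≡⟨ solve (N ∷ e ∷ k ∷ r ∷ l ∷ C ∷ []) ⟩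
  (e + l * C) * N + k * r    ≡⟨ cong (λ t → t * N + k * r) kq≡ ⟨
  k * q * N + k * r          ≡⟨ solve (k ∷ q ∷ N ∷ r ∷ []) ⟩
  k * (r + q * N)            ≡⟨ cong (k *_) CQ≡ ⟨
  k * (C * Q)                ≡⟨ solve (k ∷ C ∷ Q ∷ []) ⟩
  C * (k * Q)                ≡⟨ cong (C *_) kQ≡ ⟩
  C * (l * N + 1)            ≡⟨ solve (C ∷ l ∷ N ∷ []) ⟩
  C + l * C * N              ∎)
  where open ≡-Reasoning

Nq≡AQ+r : ∀ {C A N q₁ q₂ Q r} → N ≡ C + A → Q ≡ q₁ + q₂ → C * Q ≡ r + q₁ * N → N * q₂ ≡ A * Q + r
Nq≡AQ+r {C} {A} {q₁ = q₁} {q₂} {r = r} refl refl CQ≡ = +-cancelˡ-≡ (q₁ * (C + A)) _ _ (begin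
  q₁ * (C + A) + (C + A) * q₂         ≡⟨ solve (C ∷ A ∷ q₁ ∷ q₂ ∷ []) ⟩
  C * (q₁ + q₂) + A * (q₁ + q₂)       ≡⟨ cong (_+ A * (q₁ + q₂)) CQ≡ ⟩
  r + q₁ * (C + A) + A * (q₁ + q₂)    ≡⟨ solve (C ∷ A ∷ q₁ ∷ q₂ ∷ r ∷ []) ⟩
  q₁ * (C + A) + (A * (q₁ + q₂) + r)  ∎)
  where open ≡-Reasoning

r+mQ≡zN+1 : ∀ {C m Q N r q z} → C * Q ≡ r + q * N → (C + m) * Q ≡ (q + z) * N + 1 → r + m * Q ≡ z * N + 1
r+mQ≡zN+1 {C} {m} {Q} {N} {r} {q} {z} CQ≡ kQ≡ = +-cancelˡ-≡ (q * N) _ _ (begin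
  q * N + (r + m * Q)   ≡⟨ solve (q ∷ N ∷ r ∷ m ∷ Q ∷ []) ⟩
  (r + q * N) + m * Q   ≡⟨ cong (_+ m * Q) CQ≡ ⟨
  C * Q + m * Q         ≡⟨ *-distribʳ-+ Q C m ⟨
  (C + m) * Q           ≡⟨ kQ≡ ⟩
  (q + z) * N + 1       ≡⟨ solve (q ∷ z ∷ N ∷ []) ⟩
  q * N + (z * N + 1)   ∎)
  where open ≡-Reasoning

Ne+dr≡A : ∀ {N A m d r e z Q q} → A ≡ m + d → N * q ≡ A * Q + r → r + m * Q ≡ z * N + 1 →
          m * q ≡ e + z * A → N * e + d * r ≡ A
Ne+dr≡A {N} {m = m} {d} {r} {e} {z} {Q} {q} refl Nq≡ r+mQ≡ mq≡ = +-cancelʳ-≡ (N * z * (m + d) + m * r) _ _ (begin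
  N * e + d * r + (N * z * (m + d) + m * r)  ≡⟨ solve (N ∷ e ∷ d ∷ r ∷ z ∷ m ∷ []) ⟩
  N * (e + z * (m + d)) + (m + d) * r        ≡⟨ cong (λ t → N * t + (m + d) * r) mq≡ ⟨
  N * (m * q) + (m + d) * r                  ≡⟨ solve (N ∷ m ∷ q ∷ d ∷ r ∷ []) ⟩
  m * (N * q) + (m + d) * r                  ≡⟨ cong (λ t → m * t + (m + d) * r) Nq≡ ⟩
  m * ((m + d) * Q + r) + (m + d) * r        ≡⟨ solve (m ∷ d ∷ Q ∷ r ∷ []) ⟩
  (m + d) * (r + m * Q) + m * r              ≡⟨ cong (λ t → (m + d) * t + m * r) r+mQ≡ ⟩
  (m + d) * (z * N + 1) + m * r              ≡⟨ solve (m ∷ d ∷ z ∷ N ∷ r ∷ []) ⟩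
  (m + d) + (N * z * (m + d) + m * r)        ∎)
  where open ≡-Reasoning

-- k is the inverse of Q modulo N. If k < C = |w′|, comparing the ones in the k-prefixes of w and
-- of w′ gives N·e + k·r = C < N, where e = k·q₁ mod C and r = C·Q mod N; so e = 0 and C divides k.
-- The case k > C is excluded in the same way inside w″.
module FirstFactorLength {P Q p₁ q₁ p₂ q₂ k l : ℕ}
  (cop₁ : Coprime p₁ q₁) (cop₂ : Coprime p₂ q₂)
  (split : christoffel p₁ q₁ ++ christoffel p₂ q₂ ≡ christoffel P Q)
  (inverse : k * Q ≡ l * (P + Q) + 1) (k<N : k < P + Q)
  where

  private
    N C A : ℕ
    N = P + Q
    C = p₁ + q₁
    A = p₂ + q₂
    w₁ w₂ : BWord
    w₁ = christoffel p₁ q₁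
    w₂ = christoffel p₂ q₂

    C+A≡N : C + A ≡ N
    C+A≡N = begin
      C + A                   ≡⟨ cong₂ _+_ (length-christoffel p₁ q₁) (length-christoffel p₂ q₂) ⟨
      length w₁ + length w₂   ≡⟨ length-++ w₁ ⟨
      length (w₁ ++ w₂)       ≡⟨ cong length split ⟩
      length (christoffel P Q) ≡⟨ length-christoffel P Q ⟩
      N                       ∎
      where open ≡-Reasoning

    C<N : C < N
    C<N = subst (C <_) C+A≡N (m<m+n C (coprime⇒0<+ cop₂))

    A<N : A < N
    A<N = subst (A <_) (trans (+-comm A C) C+A≡N) (m<m+n A (coprime⇒0<+ cop₁))

    0<k : 0 < k
    0<k = n≢0⇒n>0 λ k≡0 → 1+n≢0 (trans (+-comm 1 (l * N)) (trans (sym inverse) (cong (_* Q) k≡0)))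

    ones-prefix : ∀ {m} → m ≤ N → count1 (take m (w₁ ++ w₂)) ≡ divN (m * Q) N
    ones-prefix {m} m≤N = trans (cong (count1 ∘ take m) split) (count1-take-christoffel P Q m≤N)

    ones-prefix₁ : ∀ {m} → m ≤ C → count1 (take m (w₁ ++ w₂)) ≡ divN (m * q₁) C
    ones-prefix₁ {m} m≤C = trans (cong count1 (take-++ˡ w₁ w₂ (subst (m ≤_) (sym (length-christoffel p₁ q₁)) m≤C)))
                             (count1-take-christoffel p₁ q₁ m≤C)

    ones-prefix₂ : ∀ {m} → m ≤ A → count1 (take (C + m) (w₁ ++ w₂)) ≡ q₁ + divN (m * q₂) A
    ones-prefix₂ {m} m≤A = begin
      count1 (take (C + m) (w₁ ++ w₂))          ≡⟨ cong (λ n → count1 (take (n + m) (w₁ ++ w₂))) (length-christoffel p₁ q₁) ⟨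
      count1 (take (length w₁ + m) (w₁ ++ w₂))  ≡⟨ cong count1 (take-++ʳ m w₁ w₂) ⟩
      count1 (w₁ ++ take m w₂)                  ≡⟨ count1-++ w₁ (take m w₂) ⟩
      count1 w₁ + count1 (take m w₂)            ≡⟨ cong₂ _+_ (count1-christoffel p₁ q₁) (count1-take-christoffel p₂ q₂ m≤A) ⟩
      q₁ + divN (m * q₂) A                      ∎
      where open ≡-Reasoning

    ones-k : count1 (take k (w₁ ++ w₂)) ≡ l
    ones-k = trans (ones-prefix (<⇒≤ k<N)) (divN-unique (<-≤-trans (s≤s 0<k) k<N) (trans inverse (+-comm (l * N) 1)))

    r : ℕ
    r = modN (C * Q) N

    CQ≡ : C * Q ≡ r + q₁ * N
    CQ≡ = begin
      C * Q                          ≡⟨ modN+divN (C * Q) (<-≤-trans z<s C<N) ⟩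
      r + divN (C * Q) N * N         ≡⟨ cong (λ t → r + t * N) (trans (sym (ones-prefix (<⇒≤ C<N))) (ones-prefix₁ ≤-refl)) ⟩
      r + divN (C * q₁) C * N        ≡⟨ cong (λ t → r + t * N) (divN-unique {t = q₁} (coprime⇒0<+ cop₁) (*-comm C q₁)) ⟩
      r + q₁ * N                     ∎
      where open ≡-Reasoning

    Q≡q₁+q₂ : Q ≡ q₁ + q₂
    Q≡q₁+q₂ = begin
      Q                         ≡⟨ count1-christoffel P Q ⟨
      count1 (christoffel P Q)  ≡⟨ cong count1 split ⟨
      count1 (w₁ ++ w₂)         ≡⟨ count1-++ w₁ w₂ ⟩
      count1 w₁ + count1 w₂     ≡⟨ cong₂ _+_ (count1-christoffel p₁ q₁) (count1-christoffel p₂ q₂) ⟩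
      q₁ + q₂                   ∎
      where open ≡-Reasoning

    k≮C : ¬ k < C
    k≮C k<C = <⇒≱ k<C (coprime-multiple⇒≤ {t = l} (coprime-+ʳ cop₁) 0<k kq₁≡lC)
      where
      e : ℕ
      e = modN (k * q₁) C
      kq₁≡ : k * q₁ ≡ e + l * C
      kq₁≡ = trans (modN+divN (k * q₁) (coprime⇒0<+ cop₁))
                   (cong (λ t → e + t * C) (trans (sym (ones-prefix₁ (<⇒≤ k<C))) ones-k))
      kq₁≡lC : k * q₁ ≡ l * C
      kq₁≡lC = trans kq₁≡ (cong (_+ l * C) (*-+≡<⇒≡0 (Ne+kr≡C {N} {C} {k} {r} {e} {l} {q₁} {Q} CQ≡ kq₁≡ inverse) C<N))

    C≮k : ¬ C < k
    C≮k C<k = <⇒≱ m<A (coprime-multiple⇒≤ {t = z} (coprime-+ʳ cop₂) 0<m mq₂≡zA)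
      where
      m z e : ℕ
      m = k ∸ C
      k≡C+m : k ≡ C + m
      k≡C+m = sym (m+[n∸m]≡n (<⇒≤ C<k))
      0<m : 0 < m
      0<m = m<n⇒0<n∸m C<k
      m<A : m < A
      m<A = +-cancelˡ-< C m A (subst₂ _<_ k≡C+m (sym C+A≡N) k<N)
      z = divN (m * q₂) A
      e = modN (m * q₂) A
      mq₂≡ : m * q₂ ≡ e + z * A
      mq₂≡ = modN+divN (m * q₂) (coprime⇒0<+ cop₂)
      l≡q₁+z : l ≡ q₁ + z
      l≡q₁+z = trans (sym ones-k) (trans (cong (λ n → count1 (take n (w₁ ++ w₂))) k≡C+m) (ones-prefix₂ (<⇒≤ m<A)))
      kQ≡ : (C + m) * Q ≡ (q₁ + z) * N + 1
      kQ≡ = subst₂ (λ n t → n * Q ≡ t * N + 1) k≡C+m l≡q₁+z inverse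
      Ne+dr≡A′ : N * e + (A ∸ m) * r ≡ A
      Ne+dr≡A′ = Ne+dr≡A {N} {A} {m} {A ∸ m} {r} {e} {z} {Q} {q₂} (sym (m+[n∸m]≡n (<⇒≤ m<A)))
                   (Nq≡AQ+r {C} {A} {N} {q₁} {q₂} {Q} {r} (sym C+A≡N) Q≡q₁+q₂ CQ≡)
                   (r+mQ≡zN+1 {C} {m} {Q} {N} {r} {q₁} {z} CQ≡ kQ≡) mq₂≡
      mq₂≡zA : m * q₂ ≡ z * A
      mq₂≡zA = trans mq₂≡ (cong (_+ z * A) (*-+≡<⇒≡0 Ne+dr≡A′ A<N))

  length≡ : p₁ + q₁ ≡ k
  length≡ with <-cmp k C
  ... | tri< k<C _ _ = contradiction k<C k≮C
  ... | tri≈ _ k≡C _ = sym k≡C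
  ... | tri> _ _ C<k = contradiction C<k C≮k

-- The rotation by C modulo N

MergeAt : ℕ → ℕ → ℕ → List Letter → List Letter → Set
MergeAt N q i u u′ =
  dNum N q i < modN (i * q) N × at u′ (h ∸ 1) ≡ just a × at u′ h ≡ just c
  × u ≡ take (h ∸ 1) u′ ++ b ∷ drop (suc h) u′
  where h : ℕ
        h = hNum N q i

mergeAt-intro : ∀ {N q i u u′ h₀} → hNum N q i ≡ suc h₀ → dNum N q i < modN (i * q) N →
                at u′ h₀ ≡ just a → at u′ (suc h₀) ≡ just c → u ≡ replacePair h₀ b u′ → MergeAt N q i u u′
mergeAt-intro h≡ d<K at-a at-c u≡ rewrite h≡ = d<K , at-a , at-c , u≡

module Rotation (A C N q l : ℕ) (A+C≡N : A + C ≡ N) (det : C * q + 1 ≡ N * l) where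

  instance
    N-nonZero : NonZero N
    N-nonZero = ≢-nonZero λ N≡0 → 1+n≢0 (trans (+-comm 1 (C * q)) (trans det (cong (_* l) N≡0)))

  rotate : ℕ → ℕ
  rotate z = (z + C) % N

  x : ℕ → ℕ
  x k = iter rotate k 0

  C≤N : C ≤ N
  C≤N = subst (C ≤_) A+C≡N (m≤n+m C A)

  x<N : ∀ k → x k < N
  x<N zero    = >-nonZero⁻¹ N
  x<N (suc k) = m%n<n (x k + C) N

  rotate-< : ∀ {z} → z < A → rotate z ≡ z + C
  rotate-< z<A = m<n⇒m%n≡m (subst (_ <_) A+C≡N (+-monoˡ-< C z<A))

  rotate-+ : ∀ {y} → y < C → rotate (A + y) ≡ y
  rotate-+ {y} y<C = begin
    (A + y + C) % N  ≡⟨ cong (_% N) (solve (A ∷ y ∷ C ∷ [])) ⟩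
    (y + (A + C)) % N ≡⟨ cong (λ t → (y + t) % N) A+C≡N ⟩
    (y + N) % N      ≡⟨ [m+n]%n≡m%n y N ⟩
    y % N            ≡⟨ m<n⇒m%n≡m (<-≤-trans y<C C≤N) ⟩
    y                ∎
    where open ≡-Reasoning

  x≡kC%N : ∀ k → x k ≡ (k * C) % N
  x≡kC%N zero    = sym (m<n⇒m%n≡m (>-nonZero⁻¹ N))
  x≡kC%N (suc k) = begin
    (x k + C) % N           ≡⟨ cong (λ t → (t + C) % N) (x≡kC%N k) ⟩
    ((k * C) % N + C) % N   ≡⟨ %-absorbˡ (k * C) C ⟩
    (k * C + C) % N         ≡⟨ cong (_% N) (+-comm (k * C) C) ⟩
    (suc k * C) % N         ∎
    where open ≡-Reasoning

  x[jq]≡m : ∀ {j m} → 0 < j → j + m ≡ N → x (modN (j * q) N) ≡ m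
  x[jq]≡m {j} {m} 0<j j+m≡N = begin
    x K                 ≡⟨ x≡kC%N K ⟩
    (K * C) % N         ≡⟨ %-cong-mod (K * C) m (t * C + 1) (j * l) N (identity K t jq≡K+tN) ⟩
    m % N               ≡⟨ m<n⇒m%n≡m (subst (m <_) j+m≡N (m<n+m m 0<j)) ⟩
    m                   ∎
    where
    open ≡-Reasoning
    K t : ℕ
    K = modN (j * q) N
    t = j * q / N
    jq≡K+tN : j * q ≡ K + t * N
    jq≡K+tN = trans (m≡m%n+[m/n]*n (j * q) N) (cong (_+ t * N) (sym (modN≡% (j * q) N)))
    identity : ∀ K t → j * q ≡ K + t * N → K * C + (t * C + 1) * N ≡ m + j * l * N
    identity K t jq≡ = begin
      K * C + (t * C + 1) * N   ≡⟨ solve (K ∷ C ∷ t ∷ N ∷ []) ⟩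
      C * (K + t * N) + N       ≡⟨ cong (λ u → C * u + N) jq≡ ⟨
      C * (j * q) + N           ≡⟨ cong (C * (j * q) +_) j+m≡N ⟨
      C * (j * q) + (j + m)     ≡⟨ solve (C ∷ j ∷ q ∷ m ∷ []) ⟩
      j * (C * q + 1) + m       ≡⟨ cong (λ u → j * u + m) det ⟩
      j * (N * l) + m           ≡⟨ solve (j ∷ N ∷ l ∷ m ∷ []) ⟩
      m + j * l * N             ∎

  x[k]≡m⇒jq≡k : ∀ {j m k} → k < N → j + m ≡ N → x k ≡ m → modN (j * q) N ≡ k
  x[k]≡m⇒jq≡k {j} {m} {k} k<N j+m≡N xk≡m = begin
    modN (j * q) N      ≡⟨ modN≡% (j * q) N ⟩
    (j * q) % N         ≡⟨ %-cong-mod (j * q) k (k * l) (q + s * q) N (identity s kC≡) ⟩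
    k % N               ≡⟨ m<n⇒m%n≡m k<N ⟩
    k                   ∎
    where
    open ≡-Reasoning
    s : ℕ
    s = k * C / N
    kC≡ : k * C ≡ m + s * N
    kC≡ = trans (m≡m%n+[m/n]*n (k * C) N) (cong (_+ s * N) (trans (sym (x≡kC%N k)) xk≡m))
    identity : ∀ s → k * C ≡ m + s * N → j * q + k * l * N ≡ k + (q + s * q) * N
    identity s kC≡′ = begin
      j * q + k * l * N             ≡⟨ solve (j ∷ q ∷ k ∷ l ∷ N ∷ []) ⟩
      j * q + k * (N * l)           ≡⟨ cong (λ u → j * q + k * u) det ⟨
      j * q + k * (C * q + 1)       ≡⟨ solve (j ∷ q ∷ k ∷ C ∷ []) ⟩
      k + q * j + q * (k * C)       ≡⟨ cong (λ u → k + q * j + q * u) kC≡′ ⟩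
      k + q * j + q * (m + s * N)   ≡⟨ solve (k ∷ q ∷ j ∷ m ∷ s ∷ N ∷ []) ⟩
      k + q * (j + m) + s * q * N   ≡⟨ cong (λ u → k + q * u + s * q * N) j+m≡N ⟩
      k + q * N + s * q * N         ≡⟨ solve (k ∷ q ∷ N ∷ s ∷ []) ⟩
      k + (q + s * q) * N           ∎

  x-injective : ∀ {k k′} → k < N → k′ < N → x k ≡ x k′ → k ≡ k′
  x-injective {k} {k′} k<N k′<N xk≡xk′ =
    trans (sym (x[k]≡m⇒jq≡k k<N j+m≡N refl)) (x[k]≡m⇒jq≡k k′<N j+m≡N (sym xk≡xk′))
    where j+m≡N : N ∸ x k + x k ≡ N
          j+m≡N = m∸n+n≡m (<⇒≤ (x<N k))

  below : ℕ → ℕ → Bool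
  below T k = does (x k <? T)

  visits : ℕ → ℕ → ℕ
  visits T = countBelow (below T)

  visits-suc : ∀ {j m k} → 0 < j → j + m ≡ N → k ≤ N →
               visits (suc m) k ≡ visits m k + indicator (does (modN (j * q) N <? k))
  visits-suc {j} {m} {k} 0<j j+m≡N k≤N = begin
    visits (suc m) k                                     ≡⟨ countBelow-+ (λ k′ → indicator-<-suc (x k′) m) k ⟩
    visits m k + countBelow (does ∘ (λ k′ → x k′ ≟ m)) k ≡⟨ cong (visits m k +_) (countBelow-single (λ k′ → x k′ ≟ m) xK≡m unique k≤N) ⟩
    visits m k + indicator (does (K <? k))               ∎
    where
    open ≡-Reasoning
    K : ℕ
    K = modN (j * q) N
    xK≡m : x K ≡ m
    xK≡m = x[jq]≡m 0<j j+m≡N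
    unique : ∀ {k′} → k′ < N → x k′ ≡ m → k′ ≡ K
    unique k′<N xk′≡m = x-injective k′<N (modN<M (j * q) (>-nonZero⁻¹ N)) (trans xk′≡m (sym xK≡m))

  -- The times k < N with x k ≥ N − i are exactly j·q mod N for 1 ≤ j ≤ i.
  visits+countUpTo : ∀ {i k} → i ≤ N → k ≤ N →
                     visits (N ∸ i) k + countUpTo (λ j → does (modN (j * q) N <? k)) i ≡ k
  visits+countUpTo {zero}  {k} _   _   = trans (+-identityʳ _) (countBelow-all (λ k′ → dec-true (x k′ <? N) (x<N k′)) k)
  visits+countUpTo {suc i} {k} i<N k≤N = begin
    visits m k + countUpTo P (suc i)                      ≡⟨ cong (visits m k +_) (countUpTo-suc P i) ⟩
    visits m k + (indicator (P (suc i)) + countUpTo P i)  ≡⟨ +-assoc (visits m k) _ _ ⟨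
    visits m k + indicator (P (suc i)) + countUpTo P i    ≡⟨ cong (_+ countUpTo P i) (visits-suc z<s (m+[n∸m]≡n i<N) k≤N) ⟨
    visits (suc m) k + countUpTo P i                      ≡⟨ cong (λ t → visits t k + countUpTo P i) (+-∸-assoc 1 i<N) ⟨
    visits (N ∸ i) k + countUpTo P i                      ≡⟨ visits+countUpTo (<⇒≤ i<N) k≤N ⟩
    k                                                     ∎
    where
    open ≡-Reasoning
    P : ℕ → Bool
    P j = does (modN (j * q) N <? k)
    m : ℕ
    m = N ∸ suc i

  module Coding (a′ i c′ : ℕ) (A≡ : A ≡ a′ + i) (C≡ : C ≡ c′ + i) (0<T : 0 < a′ + i + c′) where

    T : ℕ
    T = a′ + i + c′

    N≡T+i : N ≡ T + i
    N≡T+i = begin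
      N                  ≡⟨ A+C≡N ⟨
      A + C              ≡⟨ cong₂ _+_ A≡ C≡ ⟩
      a′ + i + (c′ + i)  ≡⟨ solve (a′ ∷ i ∷ c′ ∷ []) ⟩
      a′ + i + c′ + i    ∎
      where open ≡-Reasoning

    N∸i≡T : N ∸ i ≡ T
    N∸i≡T = trans (cong (_∸ i) N≡T+i) (m+n∸n≡m T i)

    T≡A+c′ : T ≡ A + c′
    T≡A+c′ = cong (_+ c′) (sym A≡)

    C≤T : C ≤ T
    C≤T = begin
      C              ≡⟨ C≡ ⟩
      c′ + i         ≤⟨ m≤n+m (c′ + i) a′ ⟩
      a′ + (c′ + i)  ≡⟨ solve (a′ ∷ c′ ∷ i ∷ []) ⟩
      a′ + i + c′    ∎
      where open ≤-Reasoning

    private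
      σ : ℕ → ℕ
      σ = sigma a′ i c′

      rotate-left : ∀ {z} → z < a′ → rotate z ≡ z + i + c′
      rotate-left {z} z<a′ = begin
        rotate z          ≡⟨ rotate-< (<-≤-trans z<a′ (subst (a′ ≤_) (sym A≡) (m≤m+n a′ i))) ⟩
        z + C             ≡⟨ cong (z +_) C≡ ⟩
        z + (c′ + i)      ≡⟨ solve (z ∷ c′ ∷ i ∷ []) ⟩
        z + i + c′        ∎
        where open ≡-Reasoning

      rotate-middle : ∀ {u} → u < i → rotate (a′ + u) ≡ A + (u + c′)
      rotate-middle {u} u<i = begin
        rotate (a′ + u)     ≡⟨ rotate-< (subst (a′ + u <_) (sym A≡) (+-monoʳ-< a′ u<i)) ⟩
        a′ + u + C          ≡⟨ cong (a′ + u +_) C≡ ⟩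
        a′ + u + (c′ + i)   ≡⟨ solve (a′ ∷ u ∷ c′ ∷ i ∷ []) ⟩
        a′ + i + (u + c′)   ≡⟨ cong (_+ (u + c′)) A≡ ⟨
        A + (u + c′)        ∎
        where open ≡-Reasoning

      rotate-right : ∀ {y} → a′ + i + y < T → rotate (a′ + i + y) ≡ y
      rotate-right {y} z<T = trans (cong (λ t → rotate (t + y)) (sym A≡))
                                   (rotate-+ (<-≤-trans (+-cancelˡ-< (a′ + i) y c′ z<T) (subst (c′ ≤_) (sym C≡) (m≤m+n c′ i))))

      σ-rotate : ∀ {z} → z < T → rotate z < T → σ z ≡ rotate z
      σ-rotate {z} z<T ρz<T with region a′ i z
      ... | left z<a′   = trans (sigma-left {a′} {i} {c′} z<a′) (sym (rotate-left z<a′))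
      ... | middle u<i  = contradiction ρz<T (≤⇒≯ (subst₂ _≤_ (sym T≡A+c′) (sym (rotate-middle u<i))
                                                          (+-monoʳ-≤ A (m≤n+m _ _))))
      ... | right y     = trans (sigma-right {a′} {i} {c′} y) (sym (rotate-right z<T))

      σ-rotate² : ∀ {z} → z < T → ¬ rotate z < T → σ z ≡ rotate (rotate z)
      σ-rotate² {z} z<T ρz≮T with region a′ i z
      ... | left z<a′        = contradiction (subst (_< T) (sym (rotate-left z<a′)) (+-monoˡ-< c′ (+-monoˡ-< i z<a′))) ρz≮T
      ... | middle {u} u<i   = trans (sigma-middle {a′} {i} {c′} u<i) (sym (trans (cong rotate (rotate-middle u<i))
                                 (rotate-+ (subst (u + c′ <_) (trans (+-comm i c′) (sym C≡)) (+-monoˡ-< c′ u<i)))))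
      ... | right y          = contradiction (subst (_< T) (sym (rotate-right z<T))
                                 (≤-<-trans (m≤n+m y (a′ + i)) z<T)) ρz≮T

      exit : ∀ {z} → z < N → ¬ rotate z < T → z < T
      exit {z} z<N ρz≮T with z <? A
      ... | yes z<A = <-≤-trans z<A (subst (A ≤_) (sym T≡A+c′) (m≤m+n A c′))
      ... | no z≮A with m≤n⇒∃[o]m+o≡n (≮⇒≥ z≮A)
      ...   | y , refl = contradiction (subst (_< T) (sym (rotate-+ y<C)) (<-≤-trans y<C C≤T)) ρz≮T
        where y<C : y < C
              y<C = +-cancelˡ-< A y C (subst (A + y <_) (sym A+C≡N) z<N)

    open FirstReturn x σ (_<? T) 0<T (λ _ → σ-rotate) (λ _ → σ-rotate²) (λ k → exit (x<N k))
      using (iter-visits)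

    visits-N : visits T N ≡ T
    visits-N = +-cancelʳ-≡ i (visits T N) T (begin
      visits T N + i                                            ≡⟨ cong (λ t → visits t N + i) N∸i≡T ⟨
      visits (N ∸ i) N + i                                      ≡⟨ cong (visits (N ∸ i) N +_) all-below ⟨
      visits (N ∸ i) N + countUpTo (λ j → does (modN (j * q) N <? N)) i ≡⟨ visits+countUpTo i≤N ≤-refl ⟩
      N                                                         ≡⟨ N≡T+i ⟩
      T + i                                                     ∎)
      where
      open ≡-Reasoning
      i≤N : i ≤ N
      i≤N = subst (i ≤_) (sym N≡T+i) (m≤n+m i T)
      all-below : countUpTo (λ j → does (modN (j * q) N <? N)) i ≡ i
      all-below = countUpTo-all (λ j → dec-true (modN (j * q) N <? N) (modN<M (j * q) (>-nonZero⁻¹ N))) i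

    visits-suc-< : ∀ {k} → x k < T → visits T (suc k) ≡ suc (visits T k)
    visits-suc-< {k} xk<T = countBelow-true {below T} {k} (dec-true (x k <? T) xk<T)

    visits<T : ∀ {k} → k < N → x k < T → visits T k < T
    visits<T {k} k<N xk<T = subst (visits T k <_) visits-N
      (<-≤-trans (subst (visits T k <_) (sym (visits-suc-< {k} xk<T)) ≤-refl) (countBelow-mono {below T} k<N))

    at-visits : ∀ {k} → k < N → x k < T → at (assocWord a′ i c′) (visits T k) ≡ just (ell a′ i (x k))
    at-visits {k} k<N xk<T = trans (at-assocWord {a′} {i} {c′} (visits<T k<N xk<T)) (cong (just ∘ ell a′ i) (iter-visits k xk<T))

    visits-preimage : ∀ {j} → j < T → ∃[ k ] k < N × x k < T × visits T k ≡ j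
    visits-preimage j<T = countBelow-preimage (λ k → x k <? T) N (subst (_ <_) (sym visits-N) j<T)

  module Merge (i a′ c′ : ℕ) (A≡ : A ≡ a′ + suc i) (C≡ : C ≡ c′ + suc i) where

    private
      0<T₁ : 0 < a′ + suc i + c′
      0<T₁ = <-≤-trans z<s (≤-trans (m≤n+m (suc i) a′) (m≤m+n (a′ + suc i) c′))

    module U  = Coding a′ (suc i) c′ A≡ C≡ 0<T₁
    module U′ = Coding (suc a′) i (suc c′) (trans A≡ (+-suc a′ i)) (trans C≡ (+-suc c′ i)) z<s

    T₁ T₀ : ℕ
    T₁ = U.T
    T₀ = U′.T

    u u′ : List Letter
    u  = assocWord a′ (suc i) c′
    u′ = assocWord (suc a′) i (suc c′)

    T₀≡1+T₁ : suc a′ + i + suc c′ ≡ suc (a′ + suc i + c′)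
    T₀≡1+T₁ = solve (a′ ∷ i ∷ c′ ∷ [])

    T₁≡a′+C : T₁ ≡ a′ + C
    T₁≡a′+C = begin
      a′ + suc i + c′    ≡⟨ solve (a′ ∷ i ∷ c′ ∷ []) ⟩
      a′ + (c′ + suc i)  ≡⟨ cong (a′ +_) C≡ ⟨
      a′ + C             ∎
      where open ≡-Reasoning

    K : ℕ
    K = modN (suc i * q) N

    K<N : K < N
    K<N = modN<M (suc i * q) (>-nonZero⁻¹ N)

    1+i+T₁≡N : suc i + T₁ ≡ N
    1+i+T₁≡N = trans (+-comm (suc i) T₁) (sym U.N≡T+i)

    xK≡T₁ : x K ≡ T₁
    xK≡T₁ = x[jq]≡m {suc i} {T₁} z<s 1+i+T₁≡N

    K₁ : ℕ
    K₁ = pred K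

    K≡1+K₁ : K ≡ suc K₁
    K≡1+K₁ = sym (suc-pred K {{≢-nonZero λ K≡0 → <⇒≢ 0<T₁ (trans (sym (cong x K≡0)) xK≡T₁)}})

    K₁<K : K₁ < K
    K₁<K = subst (K₁ <_) (sym K≡1+K₁) (n<1+n K₁)

    K₁<N : K₁ < N
    K₁<N = <-trans K₁<K K<N

    xK₁≡a′ : x K₁ ≡ a′
    xK₁≡a′ with x K₁ <? A
    ... | yes xK₁<A = +-cancelʳ-≡ C (x K₁) a′ (begin
      x K₁ + C        ≡⟨ rotate-< xK₁<A ⟨
      rotate (x K₁)   ≡⟨ cong x K≡1+K₁ ⟨
      x K             ≡⟨ xK≡T₁ ⟩
      T₁              ≡⟨ T₁≡a′+C ⟩
      a′ + C          ∎)
      where open ≡-Reasoning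
    ... | no xK₁≮A with m≤n⇒∃[o]m+o≡n (≮⇒≥ xK₁≮A)
    ...   | y , A+y≡xK₁ = contradiction (trans y≡xK xK≡T₁) (<⇒≢ (<-≤-trans y<C U.C≤T))
      where
      y<C : y < C
      y<C = +-cancelˡ-< A y C (subst₂ _<_ (sym A+y≡xK₁) (sym A+C≡N) (x<N K₁))
      y≡xK : y ≡ x K
      y≡xK = trans (sym (rotate-+ y<C)) (trans (cong rotate A+y≡xK₁) (cong x (sym K≡1+K₁)))

    xK₁<T₁ : x K₁ < T₁
    xK₁<T₁ = subst₂ _<_ (sym xK₁≡a′) (sym T₁≡a′+C) (m<m+n a′ (<-≤-trans z<s (subst (suc i ≤_) (sym C≡) (m≤n+m (suc i) c′))))

    visits-T₀ : ∀ {k} → k ≤ N → visits T₀ k ≡ visits T₁ k + indicator (does (K <? k))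
    visits-T₀ {k} k≤N = trans (cong (λ t → visits t k) T₀≡1+T₁)
                              (visits-suc {suc i} {T₁} {k} z<s 1+i+T₁≡N k≤N)

    h₀ : ℕ
    h₀ = visits T₁ K₁

    visits-T₁-K : visits T₁ K ≡ suc h₀
    visits-T₁-K = trans (cong (visits T₁) K≡1+K₁) (U.visits-suc-< {K₁} xK₁<T₁)

    visits-T₀-below-K : ∀ {k} → k < K → visits T₀ k ≡ visits T₁ k
    visits-T₀-below-K {k} k<K = begin
      visits T₀ k                                ≡⟨ visits-T₀ (<⇒≤ (<-trans k<K K<N)) ⟩
      visits T₁ k + indicator (does (K <? k))    ≡⟨ cong (λ t → visits T₁ k + indicator t) (dec-false (K <? k) (<⇒≯ k<K)) ⟩
      visits T₁ k + 0                            ≡⟨ +-identityʳ (visits T₁ k) ⟩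
      visits T₁ k                                ∎
      where open ≡-Reasoning

    visits-T₀-K : visits T₀ K ≡ suc h₀
    visits-T₀-K = begin
      visits T₀ K                                ≡⟨ visits-T₀ (<⇒≤ K<N) ⟩
      visits T₁ K + indicator (does (K <? K))    ≡⟨ cong (λ t → visits T₁ K + indicator t) (dec-false (K <? K) (n≮n K)) ⟩
      visits T₁ K + 0                            ≡⟨ +-identityʳ (visits T₁ K) ⟩
      visits T₁ K                                ≡⟨ visits-T₁-K ⟩
      suc h₀                                     ∎
      where open ≡-Reasoning

    visits-T₀-above-K : ∀ {k} → K < k → k ≤ N → visits T₀ k ≡ suc (visits T₁ k)
    visits-T₀-above-K {k} K<k k≤N = begin
      visits T₀ k                                ≡⟨ visits-T₀ k≤N ⟩
      visits T₁ k + indicator (does (K <? k))    ≡⟨ cong (λ t → visits T₁ k + indicator t) (dec-true (K <? k) K<k) ⟩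
      visits T₁ k + 1                            ≡⟨ +-comm (visits T₁ k) 1 ⟩
      suc (visits T₁ k)                          ∎
      where open ≡-Reasoning

    visits+d≡K : visits T₁ K + dNum N q (suc i) ≡ K
    visits+d≡K = subst (λ t → visits t K + dNum N q (suc i) ≡ K) U.N∸i≡T
                       (visits+countUpTo (subst (suc i ≤_) (sym U.N≡T+i) (m≤n+m (suc i) T₁)) (<⇒≤ K<N))

    hNum≡1+h₀ : hNum N q (suc i) ≡ suc h₀
    hNum≡1+h₀ = begin
      K ∸ d                 ≡⟨ cong (_∸ d) visits+d≡K ⟨
      visits T₁ K + d ∸ d   ≡⟨ m+n∸n≡m (visits T₁ K) d ⟩
      visits T₁ K           ≡⟨ visits-T₁-K ⟩
      suc h₀                ∎
      where open ≡-Reasoning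
            d : ℕ
            d = dNum N q (suc i)

    d<K : dNum N q (suc i) < K
    d<K = subst (dNum N q (suc i) <_) visits+d≡K
                (subst (λ t → dNum N q (suc i) < t + dNum N q (suc i)) (sym visits-T₁-K) (m<n+m _ z<s))

    h₀≤|u′| : h₀ ≤ length u′
    h₀≤|u′| = ≤-trans (<⇒≤ (U.visits<T K₁<N xK₁<T₁))
                      (≤-trans (n≤1+n T₁) (≤-reflexive (sym (trans (length-assocWord (suc a′) i (suc c′)) T₀≡1+T₁))))

    at-u′-h₀ : at u′ h₀ ≡ just a
    at-u′-h₀ = begin
      at u′ h₀                       ≡⟨ cong (at u′) (visits-T₀-below-K K₁<K) ⟨
      at u′ (visits T₀ K₁)           ≡⟨ U′.at-visits K₁<N (<-trans xK₁<T₁ (subst (T₁ <_) (sym T₀≡1+T₁) (n<1+n T₁))) ⟩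
      just (ell (suc a′) i (x K₁))   ≡⟨ cong just (ell-left (subst (_< suc a′) (sym xK₁≡a′) (n<1+n a′))) ⟩
      just a                         ∎
      where open ≡-Reasoning

    at-u′-1+h₀ : at u′ (suc h₀) ≡ just c
    at-u′-1+h₀ = begin
      at u′ (suc h₀)                 ≡⟨ cong (at u′) visits-T₀-K ⟨
      at u′ (visits T₀ K)            ≡⟨ U′.at-visits K<N (subst₂ _<_ (sym xK≡T₁) (sym T₀≡1+T₁) (n<1+n T₁)) ⟩
      just (ell (suc a′) i (x K))    ≡⟨ cong just (ell-right {suc a′} (subst (suc a′ + i ≤_) (sym xK≡T₁) boundary≤T₁)) ⟩
      just c                         ∎
      where open ≡-Reasoning
            boundary≤T₁ : suc a′ + i ≤ a′ + suc i + c′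
            boundary≤T₁ = subst (_≤ a′ + suc i + c′) (+-suc a′ i) (m≤m+n (a′ + suc i) c′)


    private
      x≢a′ : ∀ {k} → k < N → k ≢ K₁ → x k ≢ a′
      x≢a′ k<N k≢K₁ xk≡a′ = k≢K₁ (x-injective k<N K₁<N (trans xk≡a′ (sym xK₁≡a′)))

      at-u : ∀ {k} → k < N → x k < T₁ → at u (visits T₁ k) ≡ just (ell a′ (suc i) (x k))
      at-u = U.at-visits

      at-u′ : ∀ {k} → k < N → x k < T₁ → at u′ (visits T₀ k) ≡ just (ell (suc a′) i (x k))
      at-u′ k<N xk<T₁ = U′.at-visits k<N (<-trans xk<T₁ (subst (T₁ <_) (sym T₀≡1+T₁) (n<1+n T₁)))

      at-before : ∀ {k} → k < K₁ → x k < T₁ → at u (visits T₁ k) ≡ at (replacePair h₀ b u′) (visits T₁ k)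
      at-before {k} k<K₁ xk<T₁ = begin
        at u (visits T₁ k)                          ≡⟨ at-u k<N xk<T₁ ⟩
        just (ell a′ (suc i) (x k))                 ≡⟨ cong just (ell-moveBoundary (x≢a′ k<N (<⇒≢ k<K₁))) ⟩
        just (ell (suc a′) i (x k))                 ≡⟨ at-u′ k<N xk<T₁ ⟨
        at u′ (visits T₀ k)                         ≡⟨ cong (at u′) (visits-T₀-below-K (<-trans k<K₁ K₁<K)) ⟩
        at u′ (visits T₁ k)                         ≡⟨ at-replacePair-< b u′ j<h₀ h₀≤|u′| ⟨
        at (replacePair h₀ b u′) (visits T₁ k)      ∎
        where
        open ≡-Reasoning
        k<N : k < N
        k<N = <-trans k<K₁ K₁<N
        j<h₀ : visits T₁ k < h₀
        j<h₀ = <-≤-trans (subst (visits T₁ k <_) (sym (U.visits-suc-< {k} xk<T₁)) ≤-refl)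
                         (countBelow-mono {below T₁} k<K₁)

      at-K₁ : at u h₀ ≡ at (replacePair h₀ b u′) h₀
      at-K₁ = begin
        at u h₀                          ≡⟨ at-u K₁<N xK₁<T₁ ⟩
        just (ell a′ (suc i) (x K₁))     ≡⟨ cong (just ∘ ell a′ (suc i)) xK₁≡a′ ⟩
        just (ell a′ (suc i) a′)         ≡⟨ cong just (ell-middle {a′} ≤-refl (m<m+n a′ z<s)) ⟩
        just b                           ≡⟨ at-replacePair-≡ b u′ h₀≤|u′| ⟨
        at (replacePair h₀ b u′) h₀      ∎
        where open ≡-Reasoning

      at-after : ∀ {k} → K₁ < k → k < N → x k < T₁ → at u (visits T₁ k) ≡ at (replacePair h₀ b u′) (visits T₁ k)
      at-after {k} K₁<k k<N xk<T₁ = begin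
        at u (visits T₁ k)                          ≡⟨ at-u k<N xk<T₁ ⟩
        just (ell a′ (suc i) (x k))                 ≡⟨ cong just (ell-moveBoundary (x≢a′ k<N (>⇒≢ K₁<k))) ⟩
        just (ell (suc a′) i (x k))                 ≡⟨ at-u′ k<N xk<T₁ ⟨
        at u′ (visits T₀ k)                         ≡⟨ cong (at u′) (visits-T₀-above-K K<k (<⇒≤ k<N)) ⟩
        at u′ (suc (visits T₁ k))                   ≡⟨ at-replacePair-> b u′ h₀<j h₀≤|u′| ⟨
        at (replacePair h₀ b u′) (visits T₁ k)      ∎
        where
        open ≡-Reasoning
        K<k : K < k
        K<k = ≤∧≢⇒< (subst (_≤ k) (sym K≡1+K₁) K₁<k) λ K≡k → <⇒≢ xk<T₁ (trans (cong x (sym K≡k)) xK≡T₁)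
        h₀<j : h₀ < visits T₁ k
        h₀<j = subst (_≤ visits T₁ k) visits-T₁-K (countBelow-mono {below T₁} (<⇒≤ K<k))

      at-beyond : ∀ {j} → T₁ ≤ j → at u j ≡ at (replacePair h₀ b u′) j
      at-beyond {j} T₁≤j = begin
        at u j                        ≡⟨ at-assocWord-≥ {a′} {suc i} {c′} T₁≤j ⟩
        nothing                       ≡⟨ at-assocWord-≥ {suc a′} {i} {suc c′} (subst (_≤ suc j) (sym T₀≡1+T₁) (s≤s T₁≤j)) ⟨
        at u′ (suc j)                 ≡⟨ at-replacePair-> b u′ (<-≤-trans (U.visits<T K₁<N xK₁<T₁) T₁≤j) h₀≤|u′| ⟨
        at (replacePair h₀ b u′) j    ∎
        where open ≡-Reasoning

      at-visited : ∀ {k} → k < N → x k < T₁ → at u (visits T₁ k) ≡ at (replacePair h₀ b u′) (visits T₁ k)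
      at-visited {k} k<N xk<T₁ = case <-cmp k K₁ of λ where
        (tri< k<K₁ _ _) → at-before k<K₁ xk<T₁
        (tri≈ _ k≡K₁ _) → subst (λ k → at u (visits T₁ k) ≡ at (replacePair h₀ b u′) (visits T₁ k)) (sym k≡K₁) at-K₁
        (tri> _ _ K₁<k) → at-after K₁<k k<N xk<T₁

      at-u≡ : ∀ j → at u j ≡ at (replacePair h₀ b u′) j
      at-u≡ j = case j <? T₁ of λ where
        (no j≮T₁)  → at-beyond (≮⇒≥ j≮T₁)
        (yes j<T₁) → let k , k<N , xk<T₁ , visits≡j = U.visits-preimage j<T₁ in
                     subst (λ j → at u j ≡ at (replacePair h₀ b u′) j) visits≡j (at-visited k<N xk<T₁)

    merge : MergeAt N q (suc i) u u′
    merge = mergeAt-intro {N} {q} {suc i} {u} {u′} hNum≡1+h₀ d<K at-u′-h₀ at-u′-1+h₀ (at-extensional at-u≡)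





  merge-∸ : ∀ {i} → 0 < i → i ≤ A → i ≤ C →
            MergeAt N q i (assocWord (A ∸ i) i (C ∸ i)) (assocWord (A ∸ pred i) (pred i) (C ∸ pred i))
  merge-∸ {suc i} _ i<A i<C =
    subst₂ (λ a″ c″ → MergeAt N q (suc i) (assocWord (A ∸ suc i) (suc i) (C ∸ suc i)) (assocWord a″ i c″))
           (sym (+-∸-assoc 1 i<A)) (sym (+-∸-assoc 1 i<C))
           (Merge.merge i (A ∸ suc i) (C ∸ suc i) (sym (m∸n+n≡m i<A)) (sym (m∸n+n≡m i<C)))

  merge-at : ∀ n → let i = N ∸ 1 ∸ n; i′ = N ∸ 1 ∸ (n + 1) in
             0 < i → i ≤ A → i ≤ C →
             MergeAt N q i (assocWord (A ∸ i) i (C ∸ i)) (assocWord (A ∸ i′) i′ (C ∸ i′))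
  merge-at n 0<i i≤A i≤C =
    subst (λ t → MergeAt N q i (assocWord (A ∸ i) i (C ∸ i)) (assocWord (A ∸ t) t (C ∸ t)))
          (trans (pred[m∸n]≡m∸[1+n] (N ∸ 1) n) (cong (N ∸ 1 ∸_) (+-comm 1 n)))
          (merge-∸ 0<i i≤A i≤C)
    where i : ℕ
          i = N ∸ 1 ∸ n

-- Stern–Brocot bounds

Unimodular : Bounds → Set
Unimodular β = hi1 β * lo0 β ≡ lo1 β * hi0 β + 1

unimodular-goLeft : ∀ {β} → Unimodular β → Unimodular (goLeft β)
unimodular-goLeft {bounds l₁ l₀ h₁ h₀} det = begin
  (l₁ + h₁) * l₀            ≡⟨ *-distribʳ-+ l₀ l₁ h₁ ⟩
  l₁ * l₀ + h₁ * l₀         ≡⟨ cong (l₁ * l₀ +_) det ⟩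
  l₁ * l₀ + (l₁ * h₀ + 1)   ≡⟨ solve (l₁ ∷ l₀ ∷ h₀ ∷ []) ⟩
  l₁ * (l₀ + h₀) + 1        ∎
  where open ≡-Reasoning

unimodular-goRight : ∀ {β} → Unimodular β → Unimodular (goRight β)
unimodular-goRight {bounds l₁ l₀ h₁ h₀} det = begin
  h₁ * (l₀ + h₀)            ≡⟨ *-distribˡ-+ h₁ l₀ h₀ ⟩
  h₁ * l₀ + h₁ * h₀         ≡⟨ cong (_+ h₁ * h₀) det ⟩
  l₁ * h₀ + 1 + h₁ * h₀     ≡⟨ solve (l₁ ∷ h₀ ∷ h₁ ∷ []) ⟩
  (l₁ + h₁) * h₀ + 1        ∎
  where open ≡-Reasoning

SBStep : Bounds → Bounds → Set
SBStep β γ = γ ≡ goLeft β ⊎ γ ≡ goRight β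

path-step : ∀ {g bs} → IsSBPath g bs → ∀ k → SBStep (bs k) (bs (suc k))
path-step (_ , step) k with step k
... | inj₁ (_ , step≡) = inj₁ step≡
... | inj₂ (_ , step≡) = inj₂ step≡

unimodular-path : ∀ {g bs} → IsSBPath g bs → ∀ k → Unimodular (bs k)
unimodular-path         (bs0≡root , _) zero rewrite bs0≡root = refl
unimodular-path {g} {bs} path (suc k) with path-step {g} {bs} path k
... | inj₁ step≡ rewrite step≡ = unimodular-goLeft {bs k} (unimodular-path {g} {bs} path k)
... | inj₂ step≡ rewrite step≡ = unimodular-goRight {bs k} (unimodular-path {g} {bs} path k)

leftLength rightLength nodeLength : Bounds → ℕ
leftLength  β = lo0 β + lo1 β
rightLength β = hi0 β + hi1 β
nodeLength  β = nodeZeros β + nodeOnes β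

length-nodeWord : ∀ β → length (nodeWord β) ≡ nodeLength β
length-nodeWord β = length-christoffel (nodeZeros β) (nodeOnes β)

nodeLength≡left+right : ∀ β → nodeLength β ≡ leftLength β + rightLength β
nodeLength≡left+right (bounds l₁ l₀ h₁ h₀) = interchange l₀ h₀ l₁ h₁

SBStep-lengths : ∀ {β γ} → SBStep β γ → leftLength γ ≤ nodeLength β × rightLength γ ≤ nodeLength β
SBStep-lengths {bounds l₁ l₀ h₁ h₀} (inj₁ refl) = +-mono-≤ (m≤m+n l₀ h₀) (m≤m+n l₁ h₁) , ≤-refl
SBStep-lengths {bounds l₁ l₀ h₁ h₀} (inj₂ refl) = ≤-refl , +-mono-≤ (m≤n+m h₀ l₀) (m≤n+m h₁ l₁)

leftLength*nodeOnes : ∀ {β} → Unimodular β → leftLength β * nodeOnes β ≡ lo1 β * nodeLength β + 1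
leftLength*nodeOnes {bounds l₁ l₀ h₁ h₀} det = begin
  (l₀ + l₁) * (l₁ + h₁)                      ≡⟨ solve (l₀ ∷ l₁ ∷ h₁ ∷ []) ⟩
  l₀ * l₁ + l₁ * l₁ + l₁ * h₁ + h₁ * l₀      ≡⟨ cong (l₀ * l₁ + l₁ * l₁ + l₁ * h₁ +_) det ⟩
  l₀ * l₁ + l₁ * l₁ + l₁ * h₁ + (l₁ * h₀ + 1) ≡⟨ solve (l₀ ∷ l₁ ∷ h₁ ∷ h₀ ∷ []) ⟩
  l₁ * ((l₀ + h₀) + (l₁ + h₁)) + 1           ∎
  where open ≡-Reasoning

leftLength*nodeZeros : ∀ {β} → Unimodular β → leftLength β * nodeZeros β + 1 ≡ nodeLength β * lo0 β
leftLength*nodeZeros {bounds l₁ l₀ h₁ h₀} det = begin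
  (l₀ + l₁) * (l₀ + h₀) + 1                  ≡⟨ solve (l₀ ∷ l₁ ∷ h₀ ∷ []) ⟩
  l₀ * l₀ + l₀ * h₀ + l₁ * l₀ + (l₁ * h₀ + 1) ≡⟨ cong (l₀ * l₀ + l₀ * h₀ + l₁ * l₀ +_) det ⟨
  l₀ * l₀ + l₀ * h₀ + l₁ * l₀ + h₁ * l₀      ≡⟨ solve (l₀ ∷ l₁ ∷ h₀ ∷ h₁ ∷ []) ⟩
  ((l₀ + h₀) + (l₁ + h₁)) * l₀               ∎
  where open ≡-Reasoning

leftLength<nodeLength : ∀ {β} → Unimodular β → leftLength β < nodeLength β
leftLength<nodeLength {β@(bounds l₁ l₀ h₁ h₀)} det =
  subst (leftLength β <_) (sym (nodeLength≡left+right β)) (m<m+n (leftLength β) 0<right)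
  where
  0<right : 0 < h₀ + h₁
  0<right = <-≤-trans (n≢0⇒n>0 λ h₁≡0 → 0≢1+n (trans (cong (_* l₀) (sym h₁≡0)) (trans det (+-comm _ 1))))
                      (m≤n+m h₁ h₀)

standardFactor-lengths : ∀ {β w′ w″} → Unimodular β → IsChristoffel w′ → IsChristoffel w″ →
                         nodeWord β ≡ w′ ++ w″ → length w′ ≡ leftLength β × length w″ ≡ rightLength β
standardFactor-lengths {β} {w′} {w″} det (p₁ , q₁ , cop₁ , refl) (p₂ , q₂ , cop₂ , refl) split =
  |w′|≡ , +-cancelˡ-≡ (length w′) (length w″) (rightLength β) (begin
    length w′ + length w″          ≡⟨ length-++ w′ ⟨
    length (w′ ++ w″)              ≡⟨ cong length split ⟨
    length (nodeWord β)            ≡⟨ length-nodeWord β ⟩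
    nodeLength β                   ≡⟨ nodeLength≡left+right β ⟩
    leftLength β + rightLength β   ≡⟨ cong (_+ rightLength β) |w′|≡ ⟨
    length w′ + rightLength β      ∎)
  where
  open ≡-Reasoning
  |w′|≡ : length w′ ≡ leftLength β
  |w′|≡ = trans (length-christoffel p₁ q₁)
    (FirstFactorLength.length≡ {nodeZeros β} {nodeOnes β} {p₁} {q₁} {p₂} {q₂} {leftLength β} {lo1 β}
       cop₁ cop₂ (sym split) (leftLength*nodeOnes {β} det) (leftLength<nodeLength {β} det))

det-rotation : ∀ {β} {w′ : BWord} → Unimodular β → length w′ ≡ leftLength β →
               length w′ * count0 (nodeWord β) + 1 ≡ length (nodeWord β) * lo0 β
det-rotation {β} {w′} det |w′|≡ = begin
  length w′ * count0 (nodeWord β) + 1  ≡⟨ cong₂ (λ s t → s * t + 1) |w′|≡ (count0-christoffel (nodeZeros β) (nodeOnes β)) ⟩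
  leftLength β * nodeZeros β + 1       ≡⟨ leftLength*nodeZeros {β} det ⟩
  nodeLength β * lo0 β                 ≡⟨ cong (_* lo0 β) (length-nodeWord β) ⟨
  length (nodeWord β) * lo0 β          ∎
  where open ≡-Reasoning

index-bounds : ∀ {A C N M n} → A + C ≡ N → A ≤ M → C ≤ M → M ∸ 1 ≤ n → n + 2 ≤ N →
               0 < N ∸ 1 ∸ n × N ∸ 1 ∸ n ≤ A × N ∸ 1 ∸ n ≤ C
index-bounds {A} {C} {N} {M} {n} A+C≡N A≤M C≤M M∸1≤n n+2≤N =
  subst (0 <_) (sym (∸-+-assoc N 1 n)) (m<n⇒0<n∸m (subst (_≤ N) (+-comm n 2) n+2≤N)) ,
  bound A C A+C≡N C≤M ,
  bound C A (trans (+-comm C A) A+C≡N) A≤M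
  where
  bound : ∀ X Y → X + Y ≡ N → Y ≤ M → N ∸ 1 ∸ n ≤ X
  bound X Y X+Y≡N Y≤M = begin
    N ∸ 1 ∸ n    ≡⟨ ∸-+-assoc N 1 n ⟩
    N ∸ suc n    ≤⟨ ∸-monoʳ-≤ N (≤-trans (m≤n+m∸n M 1) (s≤s M∸1≤n)) ⟩
    N ∸ M        ≤⟨ ∸-monoʳ-≤ N Y≤M ⟩
    N ∸ Y        ≡⟨ cong (_∸ Y) X+Y≡N ⟨
    X + Y ∸ Y    ≡⟨ m+n∸n≡m X Y ⟩
    X            ∎
    where open ≤-Reasoning

proposition13 : (g : Seq) → Sturmian g → (bs : ℕ → Bounds) → IsSBPath g bs →
    (μ : ℕ) → (w' w'' : BWord) → IsChristoffel w' → IsChristoffel w'' →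
    nodeWord (bs (suc μ)) ≡ w' ++ w'' →
    let N = length (nodeWord (bs (suc μ)))
        q = count0 (nodeWord (bs (suc μ)))
    in (n : ℕ) → length (nodeWord (bs μ)) ∸ 1 ≤ n → n + 2 ≤ N →
      let i = N ∸ 1 ∸ n
          h = hNum N q i
          u' = uWord w' w'' N (n + 1)
      in dNum N q i < modN (i * q) N
         × at u' (h ∸ 1) ≡ just a
         × at u' h ≡ just c
         × uWord w' w'' N n ≡ take (h ∸ 1) u' ++ b ∷ drop (suc h) u'
proposition13 g _ bs path μ w′ w″ w′-chr w″-chr split n n≥ n+2≤N =
  Rotation.merge-at A C N (count0 (nodeWord β)) (lo0 β) A+C≡N (det-rotation {β} {w′} uni |w′|≡)
                    n (proj₁ index) (proj₁ (proj₂ index)) (proj₂ (proj₂ index))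
  where
  β : Bounds
  β = bs (suc μ)
  A C N : ℕ
  A = length w″
  C = length w′
  N = length (nodeWord β)
  uni : Unimodular β
  uni = unimodular-path {g} {bs} path (suc μ)
  A+C≡N : A + C ≡ N
  A+C≡N = trans (+-comm A C) (trans (sym (length-++ w′ {w″})) (cong length (sym split)))
  lengths : C ≡ leftLength β × A ≡ rightLength β
  lengths = standardFactor-lengths {β} uni w′-chr w″-chr split
  |w′|≡ : C ≡ leftLength β
  |w′|≡ = proj₁ lengths
  parent : leftLength β ≤ nodeLength (bs μ) × rightLength β ≤ nodeLength (bs μ)
  parent = SBStep-lengths (path-step {g} {bs} path μ)
  index : 0 < N ∸ 1 ∸ n × N ∸ 1 ∸ n ≤ A × N ∸ 1 ∸ n ≤ C
  index = index-bounds A+C≡N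
    (subst₂ _≤_ (sym (proj₂ lengths)) (sym (length-nodeWord (bs μ))) (proj₂ parent))
    (subst₂ _≤_ (sym |w′|≡) (sym (length-nodeWord (bs μ))) (proj₁ parent)) n≥ n+2≤N
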